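{- The following invariant holds for Greedy++: for any vertex $v$ and iteration $i$, $\ell_v^{(i)} \leq 2i \cdot \rho^*_G$.
   Context: Let $G=(V,E)$ be an undirected graph with $|V|=n$, $|E|=m$; for $S\subseteq V$ the degree density is $\rho(S)=e[S]/|S|$ where $e[S]$ is the number of edges induced by $S$, and $\rho_G^*=\max_S\rho(S)$. Greedy++ takes $G$ and an iteration count $T$, initializes a load vector $\ell^{(0)}=0\in\mathbb{Z}^n$, and for $i=1,\dots,T$: sets $H\leftarrow G$; while $H\neq\emptyset$, finds the vertex $u\in H$ minimizing $\ell^{(i-1)}_u+\deg_H(u)$, sets $\ell^{(i)}_u\leftarrow \ell^{(i-1)}_u+\deg_H(u)$ (where $\deg_H(u)$ is the degree of $u$ in the current remaining graph $H$), and removes $u$ and its incident edges from $H$ (tracking the densest intermediate $H$ as output). Thus $\ell^{(i)}_v$ is the cumulative load of vertex $v$ after $i$ peeling passes. -}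

module Defs where

open import Data.Nat as ℕ using (ℕ; zero; suc; _+_; _*_; NonZero)
open import Data.Fin as F using (Fin; toℕ; _≟_)
open import Data.Bool using (Bool; true; false; _∧_; not; if_then_else_; T)
open import Data.Product using (Σ; _×_; _,_)
open import Data.Integer using (+_)
open import Data.Rational as ℚ using (ℚ)
open import Relation.Binary.PropositionalEquality using (_≡_)
open import Relation.Nullary using (does)

sumF : ∀ {n} → (Fin n → ℕ) → ℕ
sumF {zero}  f = 0
sumF {suc n} f = f F.zero + sumF (λ i → f (F.suc i))

count : ∀ {n} → (Fin n → Bool) → ℕ
count p = sumF (λ i → if p i then 1 else 0)

record Graph (n : ℕ) : Set where
  field
    adj     : Fin n → Fin n → Bool
    sym     : ∀ u w → adj u w ≡ adj w u
    irrefl  : ∀ u → adj u u ≡ false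
open Graph public

VSet : ℕ → Set
VSet n = Fin n → Bool

size : ∀ {n} → VSet n → ℕ
size S = count S

-- e[S]: number of edges {u,w} (each counted once, via toℕ u < toℕ w) inside S
edges : ∀ {n} → Graph n → VSet n → ℕ
edges G S = sumF (λ u → count (λ w → S u ∧ S w ∧ adj G u w ∧ does (toℕ u ℕ.<? toℕ w)))

density : ∀ {n} → Graph n → (S : VSet n) → .{{NonZero (size S)}} → ℚ
density G S = (+ edges G S) ℚ./ size S

IsMaxDensity : ∀ {n} → Graph n → ℚ → Set
IsMaxDensity {n} G r =
  Σ (VSet n) (λ S → Σ (NonZero (size S)) (λ nz → density G S {{nz}} ≡ r))
  × (∀ (S : VSet n) (nz : NonZero (size S)) → density G S {{nz}} ℚ.≤ r)

degIn : ∀ {n} → Graph n → VSet n → Fin n → ℕ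
degIn G H u = count (λ w → H w ∧ adj G u w)

Loads : ℕ → Set
Loads n = Fin n → ℕ

remove : ∀ {n} → VSet n → Fin n → VSet n
remove H u w = H w ∧ not (does (w ≟ u))

addLoad : ∀ {n} → Loads n → Fin n → ℕ → Loads n
addLoad ℓ u d w = if does (w ≟ u) then ℓ w + d else ℓ w

-- One Greedy++ peeling pass, started from remaining set H:
-- Peel G ℓprev H ℓ ℓ' : starting with current loads ℓ, peeling the vertices of H
-- (each step removing a vertex u of H minimising ℓprev_u + deg_H(u), ties arbitrary)
-- yields loads ℓ'.  ℓprev is the load vector ℓ^(i-1) of the previous pass.
data Peel {n} (G : Graph n) (ℓprev : Loads n) : VSet n → Loads n → Loads n → Set where
  done : ∀ {H ℓ} → (∀ u → H u ≡ false) → Peel G ℓprev H ℓ ℓ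
  step : ∀ {H ℓ ℓ'} (u : Fin n) → H u ≡ true
       → (∀ w → H w ≡ true → ℓprev u + degIn G H u ℕ.≤ ℓprev w + degIn G H w)
       → Peel G ℓprev (remove H u) (addLoad ℓ u (degIn G H u)) ℓ'
       → Peel G ℓprev H ℓ ℓ'

data GreedyPP {n} (G : Graph n) : ℕ → Loads n → Set where
  init : GreedyPP G 0 (λ _ → 0)
  pass : ∀ {i ℓ ℓ'} → GreedyPP G i ℓ → Peel G ℓ (λ _ → true) ℓ ℓ'
       → GreedyPP G (suc i) ℓ'

module Submission where

-- During pass i+1 a vertex keeps its
-- previous load ℓ_v until it is peeled; at that moment it receives the minimum
-- x = ℓ_u + deg_H(u) of this priority over the remaining set H.  A minimum is at most
-- the average, and by the handshake identity Σ_{w∈H} deg_H(w) = 2 e[H], so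
--     |H| · x  ≤  Σ_{w∈H} ℓ_w + 2 e[H]  ≤  |H| · 2iρ + 2 |H| ρ,
-- using the induction hypothesis for the loads and e[H] ≤ |H| ρ (ρ bounds every density).
-- Dividing by |H| ≥ 1 gives x ≤ 2(i+1)ρ.

open import Defs
open import Data.Nat using (ℕ; _*_)
open import Data.Fin using (Fin)
open import Data.Integer using (+_)
open import Data.Rational using (ℚ; _≤_; _/_) renaming (_*_ to _*ℚ_)

open import Data.Nat as ℕ using (zero; suc; _+_; NonZero; _<?_)
import Data.Nat.Properties as ℕₚ
open import Algebra.Properties.CommutativeSemigroup ℕₚ.+-commutativeSemigroup
  using () renaming (interchange to +-interchange)
open import Data.Nat.Coprimality using (1-coprimeTo) renaming (sym to coprime-sym)
open import Data.Fin as Fin using (toℕ)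
open import Data.Fin.Properties using (toℕ-injective)
open import Data.Integer as ℤ using (ℤ)
import Data.Integer.Properties as ℤₚ
open import Data.Rational as ℚ using (mkℚ; 1ℚ; Positive)
  renaming (_+_ to _+ℚ_)
import Data.Rational.Properties as ℚₚ
import Data.Rational.Unnormalised as ℚᵘ
import Data.Rational.Unnormalised.Properties as ℚᵘₚ
open import Data.Bool using (Bool; true; false; _∧_; if_then_else_)
open import Data.Bool.Properties using (∧-zeroʳ; ∧-identityʳ; ∧-commutativeMonoid)
open import Algebra.Bundles using (CommutativeMonoid)
open import Algebra.Properties.CommutativeSemigroup
  (CommutativeMonoid.commutativeSemigroup ∧-commutativeMonoid)
  using () renaming (x∙yz≈y∙xz to ∧-swap)
open import Data.Product using (proj₂)
open import Relation.Binary.Definitions using (tri<; tri≈; tri>)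
open import Relation.Nullary using (does; yes; no)
open import Relation.Nullary.Decidable using (dec-true; dec-false)
open import Relation.Binary.PropositionalEquality as Eq
  using (_≡_; refl; trans; cong; cong₂; subst; module ≡-Reasoning)

oneIf : Bool → ℕ
oneIf b = if b then 1 else 0

sumIn : ∀ {n} → VSet n → (Fin n → ℕ) → ℕ
sumIn H f = sumF (λ w → if H w then f w else 0)

sumF-cong : ∀ {n} {f g : Fin n → ℕ} → (∀ i → f i ≡ g i) → sumF f ≡ sumF g
sumF-cong {zero}  f≗g = refl
sumF-cong {suc n} f≗g = cong₂ _+_ (f≗g Fin.zero) (sumF-cong (λ i → f≗g (Fin.suc i)))

sumF-zero : ∀ {n} → sumF {n} (λ _ → 0) ≡ 0
sumF-zero {zero}  = refl
sumF-zero {suc n} = sumF-zero {n}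

sumF-+ : ∀ {n} (f g : Fin n → ℕ) → sumF (λ i → f i + g i) ≡ sumF f + sumF g
sumF-+ {zero}  f g = refl
sumF-+ {suc n} f g = begin
  (f₀ + g₀) + sumF (λ i → f (Fin.suc i) + g (Fin.suc i))
    ≡⟨ cong (λ s → (f₀ + g₀) + s) (sumF-+ (λ i → f (Fin.suc i)) (λ i → g (Fin.suc i))) ⟩
  (f₀ + g₀) + (sumF (λ i → f (Fin.suc i)) + sumF (λ i → g (Fin.suc i)))
    ≡⟨ +-interchange f₀ g₀ _ _ ⟩
  (f₀ + sumF (λ i → f (Fin.suc i))) + (g₀ + sumF (λ i → g (Fin.suc i))) ∎
  where
  open ≡-Reasoning
  f₀ g₀ : ℕ
  f₀ = f Fin.zero
  g₀ = g Fin.zero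

sumF-swap : ∀ {m n} (h : Fin m → Fin n → ℕ) →
  sumF (λ u → sumF (λ w → h u w)) ≡ sumF (λ w → sumF (λ u → h u w))
sumF-swap {zero}  {n} h = Eq.sym (sumF-zero {n})
sumF-swap {suc m} h =
  trans (cong (λ s → sumF (h Fin.zero) + s) (sumF-swap (λ u → h (Fin.suc u))))
        (Eq.sym (sumF-+ (h Fin.zero) (λ w → sumF (λ u → h (Fin.suc u) w))))

sumIn-+ : ∀ {n} (H : VSet n) (f g : Fin n → ℕ) →
  sumIn H (λ w → f w + g w) ≡ sumIn H f + sumIn H g
sumIn-+ H f g =
  trans (sumF-cong split) (sumF-+ (λ w → if H w then f w else 0) (λ w → if H w then g w else 0))
  where
  split : ∀ w → (if H w then f w + g w else 0)
                ≡ (if H w then f w else 0) + (if H w then g w else 0)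
  split w with H w
  ... | true  = refl
  ... | false = refl

count-pos : ∀ {n} (H : VSet n) u → H u ≡ true → 1 ℕ.≤ count H
count-pos H Fin.zero    Hu rewrite Hu = ℕ.s≤s ℕ.z≤n
count-pos H (Fin.suc u) Hu =
  ℕₚ.≤-trans (count-pos (λ w → H (Fin.suc w)) u Hu) (ℕₚ.m≤n+m _ (oneIf (H Fin.zero)))

min≤average : ∀ {n} (H : VSet n) (f : Fin n → ℕ) x →
  (∀ w → H w ≡ true → x ℕ.≤ f w) → count H * x ℕ.≤ sumIn H f
min≤average {zero}  H f x low = ℕ.z≤n
min≤average {suc n} H f x low
  with H Fin.zero in H₀
     | min≤average (λ w → H (Fin.suc w)) (λ w → f (Fin.suc w)) x (λ w → low (Fin.suc w))
... | true  | rest = ℕₚ.+-mono-≤ (low Fin.zero H₀) rest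
... | false | rest = rest

orderedEdge : ∀ {n} → Graph n → VSet n → Fin n → Fin n → ℕ
orderedEdge G H u w = oneIf (H u ∧ H w ∧ adj G u w ∧ does (toℕ u <? toℕ w))

-- An edge {u, w} inside H is counted by exactly one of its two orientations,
-- because adjacency is symmetric and irreflexive and toℕ is injective.
edge-split : ∀ {n} (G : Graph n) (H : VSet n) u w →
  oneIf (H u ∧ (H w ∧ adj G u w)) ≡ orderedEdge G H u w + orderedEdge G H w u
edge-split G H u w with ℕₚ.<-cmp (toℕ u) (toℕ w)
... | tri< u<w _ _
  rewrite dec-true  (toℕ u <? toℕ w) u<w | dec-false (toℕ w <? toℕ u) (ℕₚ.<-asym u<w)
        | Graph.sym G w u | ∧-identityʳ (adj G u w) | ∧-zeroʳ (adj G u w)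
        | ∧-zeroʳ (H u) | ∧-zeroʳ (H w) | ℕₚ.+-identityʳ (oneIf (H u ∧ (H w ∧ adj G u w)))
  = refl
... | tri> _ _ w<u
  rewrite dec-false (toℕ u <? toℕ w) (ℕₚ.<-asym w<u) | dec-true  (toℕ w <? toℕ u) w<u
        | Graph.sym G w u | ∧-identityʳ (adj G u w) | ∧-zeroʳ (adj G u w)
        | ∧-zeroʳ (H w) | ∧-zeroʳ (H u) | ∧-swap (H u) (H w) (adj G u w)
  = refl
... | tri≈ _ u≡w _
  rewrite toℕ-injective u≡w | irrefl G w | ∧-zeroʳ (H w) | ∧-zeroʳ (H w)
  = refl

handshake : ∀ {n} (G : Graph n) (H : VSet n) →
  sumIn H (degIn G H) ≡ edges G H + edges G H
handshake G H = begin
  sumIn H (degIn G H)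
    ≡⟨ sumF-cong (λ u → restrict (H u) (λ w → H w ∧ adj G u w)) ⟩
  sumF (λ u → count (λ w → H u ∧ (H w ∧ adj G u w)))
    ≡⟨ sumF-cong (λ u → sumF-cong (edge-split G H u)) ⟩
  sumF (λ u → sumF (λ w → e u w + e w u))
    ≡⟨ sumF-cong (λ u → sumF-+ (e u) (λ w → e w u)) ⟩
  sumF (λ u → sumF (e u) + sumF (λ w → e w u))
    ≡⟨ sumF-+ (λ u → sumF (e u)) (λ u → sumF (λ w → e w u)) ⟩
  edges G H + sumF (λ u → sumF (λ w → e w u))
    ≡⟨ cong (λ s → edges G H + s) (Eq.sym (sumF-swap e)) ⟩
  edges G H + edges G H ∎
  where
  open ≡-Reasoning
  e : Fin _ → Fin _ → ℕ
  e = orderedEdge G H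
  restrict : ∀ {n} (b : Bool) (p : Fin n → Bool) →
    (if b then count p else 0) ≡ count (λ w → b ∧ p w)
  restrict true      p = refl
  restrict {n} false p = Eq.sym (sumF-zero {n})

priority : ∀ {n} → Graph n → Loads n → VSet n → Fin n → ℕ
priority G ℓprev H u = ℓprev u + degIn G H u

IsPeelMin : ∀ {n} → Graph n → Loads n → VSet n → Fin n → Set
IsPeelMin G ℓprev H u = ∀ w → H w ≡ true → priority G ℓprev H u ℕ.≤ priority G ℓprev H w

-- Invariant of one pass: unpeeled vertices still carry their previous load, and a
-- peeled vertex u receives exactly priority G ℓprev H u.
peel-invariant : ∀ {n} {G : Graph n} {ℓprev : Loads n} (P : ℕ → Set)
  → (∀ H u → H u ≡ true → IsPeelMin G ℓprev H u → P (priority G ℓprev H u))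
  → ∀ {H ℓ ℓ'} → Peel G ℓprev H ℓ ℓ'
  → (∀ w → H w ≡ true → ℓ w ≡ ℓprev w)
  → (∀ w → H w ≡ false → P (ℓ w))
  → ∀ w → P (ℓ' w)
peel-invariant P at-min (done empty) unpeeled peeled w = peeled w (empty w)
peel-invariant {n} {G} {ℓprev} P at-min {H} {ℓ} (step u Hu u-min rest) unpeeled peeled =
  peel-invariant P at-min rest unpeeled′ peeled′
  where
  ℓ₁ : Loads n
  ℓ₁ = addLoad ℓ u (degIn G H u)
  unpeeled′ : ∀ w → remove H u w ≡ true → ℓ₁ w ≡ ℓprev w
  unpeeled′ w w∈H′ with H w in Hw | w Fin.≟ u
  ... | true  | no _ = unpeeled w Hw
  ... | true  | yes _ with () ← w∈H′
  ... | false | _     with () ← w∈H′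
  peeled′ : ∀ w → remove H u w ≡ false → P (ℓ₁ w)
  peeled′ w w∉H′ with w Fin.≟ u
  ... | yes refl = subst (λ l → P (l + degIn G H u)) (Eq.sym (unpeeled u Hu)) (at-min H u Hu u-min)
  ... | no _ with H w in Hw
  ... | true  with () ← w∉H′
  ... | false = peeled w Hw

peelMin≤average : ∀ {n} (G : Graph n) (ℓprev : Loads n) (H : VSet n) u →
  IsPeelMin G ℓprev H u →
  count H * priority G ℓprev H u ℕ.≤ sumIn H ℓprev + (edges G H + edges G H)
peelMin≤average G ℓprev H u u-min = begin
  count H * priority G ℓprev H u         ≤⟨ min≤average H (priority G ℓprev H) _ u-min ⟩
  sumIn H (priority G ℓprev H)           ≡⟨ sumIn-+ H ℓprev (degIn G H) ⟩
  sumIn H ℓprev + sumIn H (degIn G H)    ≡⟨ cong (λ s → sumIn H ℓprev + s) (handshake G H) ⟩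
  sumIn H ℓprev + (edges G H + edges G H) ∎
  where open ℕₚ.≤-Reasoning

ι : ℕ → ℚ
ι k = + k / 1

-- ι k is already in normal form k/1; this reduces its arithmetic to that of ℤ.
ι-mkℚ : ∀ k → ι k ≡ mkℚ (+ k) 0 (coprime-sym (1-coprimeTo k))
ι-mkℚ k = ℚₚ.↥p/↧p≡p _

ι-+ : ∀ a b → ι (a + b) ≡ ι a +ℚ ι b
ι-+ a b rewrite ι-mkℚ a | ι-mkℚ b =
  ℚₚ./-cong (Eq.sym (cong₂ ℤ._+_ (ℤₚ.*-identityʳ (+ a)) (ℤₚ.*-identityʳ (+ b)))) refl

ι-* : ∀ a b → ι (a * b) ≡ ι a *ℚ ι b
ι-* a b rewrite ι-mkℚ a | ι-mkℚ b = ℚₚ./-cong (ℤₚ.pos-* a b) refl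

ι-mono : ∀ {a b} → a ℕ.≤ b → ι a ≤ ι b
ι-mono {a} {b} a≤b rewrite ι-mkℚ a | ι-mkℚ b =
  ℚ.*≤* (ℤₚ.*-monoʳ-≤-nonNeg (+ 1) (ℤ.+≤+ a≤b))

ι-pos : ∀ m → Positive (ι (suc m))
ι-pos m = ℚₚ.normalize-pos (suc m) 1

cancel-denominator : ∀ (i : ℤ) m → ι (suc m) *ℚ (i / suc m) ≡ i / 1
cancel-denominator i m = ℚₚ.toℚᵘ-injective (begin
  ℚ.toℚᵘ (ι (suc m) *ℚ (i / suc m))
    ≈⟨ ℚₚ.toℚᵘ-homo-* (ι (suc m)) (i / suc m) ⟩
  ℚ.toℚᵘ (ι (suc m)) ℚᵘ.* ℚ.toℚᵘ (i / suc m)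
    ≈⟨ ℚᵘₚ.*-cong (ℚₚ.toℚᵘ-fromℚᵘ (ℚᵘ.mkℚᵘ (+ suc m) 0)) (ℚₚ.toℚᵘ-fromℚᵘ (ℚᵘ.mkℚᵘ i m)) ⟩
  ℚᵘ.mkℚᵘ (+ suc m) 0 ℚᵘ.* ℚᵘ.mkℚᵘ i m
    ≈⟨ ℚᵘ.*≡* cross-multiplied ⟩
  ℚᵘ.mkℚᵘ i 0
    ≈⟨ ℚᵘₚ.≃-sym (ℚₚ.toℚᵘ-fromℚᵘ (ℚᵘ.mkℚᵘ i 0)) ⟩
  ℚ.toℚᵘ (i / 1) ∎)
  where
  open ℚᵘₚ.≃-Reasoning
  cross-multiplied : (+ suc m ℤ.* i) ℤ.* + 1 ≡ i ℤ.* + suc (m + 0)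
  cross-multiplied = trans (ℤₚ.*-identityʳ _) (trans (ℤₚ.*-comm (+ suc m) i)
                       (cong (λ k → i ℤ.* + suc k) (Eq.sym (ℕₚ.+-identityʳ m))))

density⇒edges≤ : ∀ (r : ℚ) E a .{{_ : NonZero a}} → (+ E) / a ≤ r → ι E ≤ ι a *ℚ r
density⇒edges≤ r E (suc m) E/a≤r = begin
  ι E                          ≡⟨ Eq.sym (cancel-denominator (+ E) m) ⟩
  ι (suc m) *ℚ ((+ E) / suc m) ≤⟨ ℚₚ.*-monoˡ-≤-nonNeg (ι (suc m)) {{ℚₚ.pos⇒nonNeg (ι (suc m)) {{ι-pos m}}}} E/a≤r ⟩
  ι (suc m) *ℚ r               ∎
  where open ℚₚ.≤-Reasoning

sumIn-bound : ∀ {n} (H : VSet n) (f : Fin n → ℕ) (c : ℚ) →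
  (∀ w → ι (f w) ≤ c) → ι (sumIn H f) ≤ ι (count H) *ℚ c
sumIn-bound {zero}  H f c f≤c = ℚₚ.≤-reflexive (Eq.sym (ℚₚ.*-zeroˡ c))
sumIn-bound {suc n} H f c f≤c with H Fin.zero
... | false = sumIn-bound (λ w → H (Fin.suc w)) (λ w → f (Fin.suc w)) c (λ w → f≤c (Fin.suc w))
... | true  = begin
  ι (f Fin.zero + S)        ≡⟨ ι-+ (f Fin.zero) S ⟩
  ι (f Fin.zero) +ℚ ι S     ≤⟨ ℚₚ.+-mono-≤ (f≤c Fin.zero) rest ⟩
  c +ℚ ι k *ℚ c             ≡⟨ cong (_+ℚ ι k *ℚ c) (Eq.sym (ℚₚ.*-identityˡ c)) ⟩
  1ℚ *ℚ c +ℚ ι k *ℚ c       ≡⟨ Eq.sym (ℚₚ.*-distribʳ-+ c 1ℚ (ι k)) ⟩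
  (1ℚ +ℚ ι k) *ℚ c          ≡⟨ cong (_*ℚ c) (Eq.sym (ι-+ 1 k)) ⟩
  ι (suc k) *ℚ c            ∎
  where
  open ℚₚ.≤-Reasoning
  S k : ℕ
  S = sumIn (λ w → H (Fin.suc w)) (λ w → f (Fin.suc w))
  k = count (λ w → H (Fin.suc w))
  rest : ι S ≤ ι k *ℚ c
  rest = sumIn-bound (λ w → H (Fin.suc w)) (λ w → f (Fin.suc w)) c (λ w → f≤c (Fin.suc w))

average-step : ∀ {a x L E : ℕ} {c r : ℚ} → 1 ℕ.≤ a → a * x ℕ.≤ L + (E + E)
  → ι L ≤ ι a *ℚ c → ι E ≤ ι a *ℚ r → ι x ≤ c +ℚ (r +ℚ r)
average-step {suc m} {x} {L} {E} {c} {r} _ ax≤L+2E L≤ac E≤ar =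
  ℚₚ.*-cancelˡ-≤-pos (ι a) {{ι-pos m}} (begin
    ι a *ℚ ι x                                    ≡⟨ Eq.sym (ι-* a x) ⟩
    ι (a * x)                                     ≤⟨ ι-mono ax≤L+2E ⟩
    ι (L + (E + E))                               ≡⟨ trans (ι-+ L (E + E)) (cong (ι L +ℚ_) (ι-+ E E)) ⟩
    ι L +ℚ (ι E +ℚ ι E)                           ≤⟨ ℚₚ.+-mono-≤ L≤ac (ℚₚ.+-mono-≤ E≤ar E≤ar) ⟩
    ι a *ℚ c +ℚ (ι a *ℚ r +ℚ ι a *ℚ r)            ≡⟨ cong (ι a *ℚ c +ℚ_) (Eq.sym (ℚₚ.*-distribˡ-+ (ι a) r r)) ⟩
    ι a *ℚ c +ℚ ι a *ℚ (r +ℚ r)                   ≡⟨ Eq.sym (ℚₚ.*-distribˡ-+ (ι a) c (r +ℚ r)) ⟩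
    ι a *ℚ (c +ℚ (r +ℚ r))                        ∎)
  where
  open ℚₚ.≤-Reasoning
  a : ℕ
  a = suc m

two-step : ∀ i (r : ℚ) → ι (2 * i) *ℚ r +ℚ (r +ℚ r) ≡ ι (2 * suc i) *ℚ r
two-step i r = Eq.sym (begin
  ι (2 * suc i) *ℚ r              ≡⟨ cong (λ k → ι k *ℚ r) (ℕₚ.*-suc 2 i) ⟩
  ι (2 + 2 * i) *ℚ r              ≡⟨ cong (_*ℚ r) (ι-+ 2 (2 * i)) ⟩
  (ι 2 +ℚ ι (2 * i)) *ℚ r         ≡⟨ ℚₚ.*-distribʳ-+ r (ι 2) (ι (2 * i)) ⟩
  ι 2 *ℚ r +ℚ ι (2 * i) *ℚ r      ≡⟨ ℚₚ.+-comm (ι 2 *ℚ r) (ι (2 * i) *ℚ r) ⟩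
  ι (2 * i) *ℚ r +ℚ ι 2 *ℚ r      ≡⟨ cong (ι (2 * i) *ℚ r +ℚ_) double ⟩
  ι (2 * i) *ℚ r +ℚ (r +ℚ r)      ∎)
  where
  open ≡-Reasoning
  double : ι 2 *ℚ r ≡ r +ℚ r
  double = trans (cong (_*ℚ r) (ι-+ 1 1))
             (trans (ℚₚ.*-distribʳ-+ r 1ℚ 1ℚ) (cong₂ _+ℚ_ (ℚₚ.*-identityˡ r) (ℚₚ.*-identityˡ r)))

DensityBound : ∀ {n} → Graph n → ℚ → Set
DensityBound {n} G r = ∀ (S : VSet n) (nz : NonZero (size S)) → density G S {{nz}} ≤ r

load-bound : ∀ {n} (G : Graph n) (r : ℚ) → DensityBound G r
  → ∀ {i ℓ} → GreedyPP G i ℓ → ∀ v → ι (ℓ v) ≤ ι (2 * i) *ℚ r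
load-bound G r bound init v = ℚₚ.≤-reflexive (Eq.sym (ℚₚ.*-zeroˡ r))
load-bound G r bound (pass {i} {ℓ} previous peel) =
  peel-invariant P at-min peel (λ _ _ → refl) (λ _ ())
  where
  P : ℕ → Set
  P k = ι k ≤ ι (2 * suc i) *ℚ r
  at-min : ∀ H u → H u ≡ true → IsPeelMin G ℓ H u → P (priority G ℓ H u)
  at-min H u u∈H u-min =
    subst (ι (priority G ℓ H u) ≤_) (two-step i r)
      (average-step {x = priority G ℓ H u} {sumIn H ℓ} {edges G H} {ι (2 * i) *ℚ r} {r}
        (count-pos H u u∈H) (peelMin≤average G ℓ H u u-min)
        (sumIn-bound H ℓ (ι (2 * i) *ℚ r) (load-bound G r bound previous))
        (density⇒edges≤ r (edges G H) (count H) {{nonempty}} (bound H nonempty)))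
    where
    nonempty : NonZero (count H)
    nonempty = ℕ.>-nonZero (count-pos H u u∈H)

lemma2 : ∀ {n} (G : Graph n) (r : ℚ) → IsMaxDensity G r
       → ∀ (i : ℕ) (ℓ : Loads n) → GreedyPP G i ℓ
       → ∀ (v : Fin n) → (+ ℓ v) / 1 ≤ ((+ (2 * i)) / 1) *ℚ r
lemma2 G r maximal i ℓ run = load-bound G r (proj₂ maximal) run
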